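{- Let $r\ge 3$ be odd, let $n\ge r$, and let $g=\Psi_{2,n}^{(r-1,r)}f$ for some $f\in\mathcal{H}_n^{(r-1)}(\mathbb{F}_2)$, where $(\Psi_{2,n}^{(r-1,r)}f)(e)=\sum_{e'\subseteq e,\ |e'|=r-1} f(e')$ for every $r$-element subset $e$ of the vertex set $V$. Let $X\subseteq V$ and $c\in\mathbb{F}_2$, and suppose $g(e)=c$ for every $r$-element subset $e\subseteq X$ (i.e. the image of the subhypergraph $K$ of $K_n^{(r-1)}$ induced by $X$ is complete in color $c$). Then the $(r-1)$-uniform hypergraph with vertex set $X$ whose hyperedges are the $(r-1)$-element subsets $e'\subseteq X$ with $f(e')=c$ has at most $r-1$ connected components.
   Context: $\mathbb{F}_2$ is the field with two elements. For $2\le k\le n$, $K_n^{(k)}$ is the complete $k$-uniform hypergraph on a fixed $n$-element vertex set $V$ (hyperedges: all $k$-element subsets of $V$), and $\mathcal{H}_n^{(k)}(\mathbb{F}_2)$ is the set of all maps $E(K_n^{(k)})\to\mathbb{F}_2$. Connected components of a hypergraph: two vertices lie in the same component if they are joined by a finite sequence of hyperedges, consecutive ones intersecting; a vertex lying in no hyperedge forms its own component. -}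

module Defs where

open import Data.Nat using (ℕ; zero; suc; _≤_; _∸_)
open import Data.Bool using (Bool; true; false; _xor_)
open import Data.Fin using (Fin)
open import Data.Fin.Subset using (Subset; Side; inside; outside; _⊆_; _∈_; ∣_∣)
open import Data.Fin.Subset.Properties using (_⊆?_)
open import Data.Vec using (_∷_; [])
open import Data.List using (List; []; _∷_; map; _++_; filter; foldr; length)
open import Data.List.Relation.Unary.Any using (Any)
open import Data.Product using (_×_; Σ; ∃; _,_)
open import Relation.Binary.PropositionalEquality using (_≡_)
open import Relation.Nullary using (Dec; yes; no; _×-dec_)
open import Data.Nat.Properties using (_≟_)
open import Relation.Binary.Construct.Closure.ReflexiveTransitive using (Star)

-- F₂ is represented by Bool with addition _xor_ (false = 0, true = 1).
F₂ : Set
F₂ = Bool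

-- The vertex set V is Fin n; a (hyper)edge is a subset of V.
-- A k-edge colouring f ∈ H_n^(k)(F₂) is given as a map on subsets; only its
-- values on k-element subsets are ever used.
Colouring : ℕ → Set
Colouring n = Subset n → F₂

allSubsets : (n : ℕ) → List (Subset n)
allSubsets zero = [] ∷ []
allSubsets (suc n) = map (outside ∷_) (allSubsets n) ++ map (inside ∷_) (allSubsets n)

sumF₂ : List F₂ → F₂
sumF₂ = foldr _xor_ false

subsetsOfSize : ∀ {n} → ℕ → Subset n → List (Subset n)
subsetsOfSize {n} k e = filter (λ e' → (e' ⊆? e) ×-dec (∣ e' ∣ ≟ k)) (allSubsets n)

Ψ : ∀ {n} (k : ℕ) → Colouring n → Colouring n
Ψ k f e = sumF₂ (map f (subsetsOfSize k e))

IsHyperedge : ∀ {n} (k : ℕ) (f : Colouring n) (X : Subset n) (c : F₂) → Subset n → Set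
IsHyperedge k f X c h = h ⊆ X × ∣ h ∣ ≡ k × f h ≡ c

Adjacent : ∀ {n} (k : ℕ) (f : Colouring n) (X : Subset n) (c : F₂) → Fin n → Fin n → Set
Adjacent k f X c u v = ∃ λ h → IsHyperedge k f X c h × u ∈ h × v ∈ h

-- same connected component: reflexive-transitive closure of adjacency
-- (equivalently: joined by a finite sequence of consecutively intersecting hyperedges)
Connected : ∀ {n} (k : ℕ) (f : Colouring n) (X : Subset n) (c : F₂) → Fin n → Fin n → Set
Connected k f X c = Star (Adjacent k f X c)

-- the hypergraph on X has at most m connected components: there are at most m
-- vertices of X such that every vertex of X lies in the component of one of them
AtMostComponents : ∀ {n} (m k : ℕ) (f : Colouring n) (X : Subset n) (c : F₂) → Set
AtMostComponents {n} m k f X c =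
  Σ (List (Fin n)) λ reps → length reps ≤ m ×
    (∀ v → v ∈ X → Any (λ u → u ∈ X × Connected k f X c v u) reps)

{-# OPTIONS --safe #-}
-- Choose greedily a maximal family of pairwise non-adjacent vertices of X.  Every vertex of X
-- lies in, or is adjacent to, a member of the family, so the family bounds the number of
-- components.  If it had r members, they would span an r-set e ⊆ X each of whose r subsets
-- of size r - 1 contains two non-adjacent vertices and hence has colour ¬ c; then
-- Ψ f e = r · ¬ c = ¬ c because r is odd, contradicting Ψ f e = c.
module Submission where

open import Defs
open import Data.Nat using (ℕ; _≤_; _∸_; _%_)
open import Data.Fin.Subset using (Subset; _⊆_; ∣_∣)
open import Relation.Binary.PropositionalEquality using (_≡_)

open import Level using (Level; _⊔_)
open import Data.Nat using (zero; suc; _+_; _⊓_; s≤s; _≤?_)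
open import Data.Nat.Properties
  using (_≟_; +-comm; +-identityʳ; n≤1+n; m+n∸n≡m; suc-injective; ≰⇒>; m≤n⇒m⊓n≡m)
open import Data.Nat.Combinatorics using (_C_; nCk≡nC[n∸k]; nC1≡n; nCk+nC[k+1]≡[n+1]C[k+1])
open import Data.Bool using (not; _xor_)
open import Data.Bool.Properties
  using (xor-assoc; xor-same; xor-identityʳ; ¬-not; not-¬) renaming (_≟_ to _≟ᴮ_)
open import Data.Fin as Fin using (Fin)
import Data.Fin.Properties as Fin
open import Data.Fin.Subset using (Side; inside; outside; _∈_; _∉_; Nonempty; ⁅_⁆; _∪_; ⋃)
open import Data.Fin.Subset.Properties
  using (_⊆?_; _∈?_; drop-∷-⊆; out⊆; in⊆in; ∉⊥; x∈p∪q⁻; x∈⁅y⁆⇒x≡y; ∣⊥∣≡0; ∪-identityˡ)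
open import Data.Vec using (_∷_; []; here; there)
open import Data.List using (List; []; _∷_; map; _++_; filter; length; take; allFin)
open import Data.List.Properties
  using (length-++; length-map; length-take; filter-++; filter-≐; filter-none)
open import Data.List.Relation.Unary.Any as Any using (Any; here; there; satisfied)
open import Data.List.Relation.Unary.All as All using (All; []; _∷_)
import Data.List.Relation.Unary.All.Properties as All
open import Data.List.Relation.Unary.AllPairs as AllPairs using (AllPairs; []; _∷_)
import Data.List.Relation.Unary.AllPairs.Properties as AllPairs
open import Data.List.Membership.Propositional using (lose) renaming (_∈_ to _∈ᴸ_)
open import Data.List.Membership.Propositional.Properties
  using (∈-filter⁻; ∈-map⁺; ∈-++⁺ˡ; ∈-++⁺ʳ; ∈-allFin)
open import Data.Product using (_×_; Σ; ∃; ∃₂; _,_)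
open import Data.Sum using (_⊎_; inj₁; inj₂)
open import Function using (_∘_)
open import Relation.Nullary using (¬_; yes; no; _×-dec_; _⊎-dec_; contradiction)
open import Relation.Nullary.Decidable using (map′)
open import Relation.Unary using (Pred; Decidable; _≐_)
open import Relation.Binary using (Rel; Symmetric; DecidableEquality)
open import Relation.Binary.PropositionalEquality using (refl; sym; trans; cong; cong₂; subst; _≢_)
open import Relation.Binary.Construct.Closure.ReflexiveTransitive using (ε; _◅_)

open Relation.Binary.PropositionalEquality.≡-Reasoning

private
  variable
    a ℓ : Level
    A : Set a
    n : ℕ

[1+k]Ck≡1+k : ∀ k → suc k C k ≡ suc k
[1+k]Ck≡1+k k = begin
  suc k C k           ≡⟨ nCk≡nC[n∸k] (n≤1+n k) ⟩
  suc k C (suc k ∸ k) ≡⟨ cong (suc k C_) (m+n∸n≡m 1 k) ⟩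
  suc k C 1           ≡⟨ nC1≡n (suc k) ⟩
  suc k               ∎

sumF₂-constant : ∀ {d} {xs : List F₂} → All (_≡ d) xs → length xs % 2 ≡ 1 → sumF₂ xs ≡ d
sumF₂-constant {d} (refl ∷ []) _ = xor-identityʳ d
sumF₂-constant {d} {_ ∷ _ ∷ xs} (refl ∷ refl ∷ ds) odd = begin
  d xor (d xor sumF₂ xs) ≡⟨ sym (xor-assoc d d (sumF₂ xs)) ⟩
  (d xor d) xor sumF₂ xs ≡⟨ cong (_xor sumF₂ xs) (xor-same d) ⟩
  sumF₂ xs               ≡⟨ sumF₂-constant ds odd ⟩
  d                      ∎

length-filter-map : ∀ {B : Set} {P : Pred B ℓ} (P? : Decidable P) (g : A → B) (xs : List A) →
                    length (filter P? (map g xs)) ≡ length (filter (P? ∘ g) xs)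
length-filter-map P? g [] = refl
length-filter-map P? g (x ∷ xs) with P? (g x)
... | yes _ = cong suc (length-filter-map P? g xs)
... | no _  = length-filter-map P? g xs

module Greedy {A : Set a} (_≟_ : DecidableEquality A) {P : Pred A ℓ} (P? : Decidable P)
              {R : Rel A ℓ} (R? : ∀ x → Decidable (R x)) where

  Dominated : List A → A → Set (a ⊔ ℓ)
  Dominated L x = Any (λ u → P u × (x ≡ u ⊎ R x u)) L

  maximalIndependent : (xs : List A) →
    Σ (List A) λ L → All P L × AllPairs (λ u v → u ≢ v × ¬ R u v) L ×
                     (∀ {x} → x ∈ᴸ xs → P x → Dominated L x)
  maximalIndependent [] = [] , [] , [] , λ ()
  maximalIndependent (x ∷ xs) with maximalIndependent xs
  ... | L , pL , indL , domL
      with P? x | Any.any? (λ u → P? u ×-dec ((x ≟ u) ⊎-dec R? x u)) L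
  ... | no ¬px | _ = L , pL , indL , λ where (here refl) px → contradiction px ¬px
                                             (there m)        → domL m
  ... | yes _ | yes d = L , pL , indL , λ where (here refl) _ → d
                                                (there m)     → domL m
  ... | yes px | no ¬d =
    x ∷ L , px ∷ pL , All.tabulate independent ∷ indL ,
    λ where (here refl) _ → here (px , inj₁ refl)
            (there m) py  → there (domL m py)
    where
    independent : ∀ {u} → u ∈ᴸ L → x ≢ u × ¬ R x u
    independent m = (λ x≡u → ¬d (lose m (All.lookup pL m , inj₁ x≡u)))
                  , (λ xRu → ¬d (lose m (All.lookup pL m , inj₂ xRu)))

AllPairs-lookup : ∀ {R : Rel A ℓ} {L : List A} {u v : A} → AllPairs R L →
                  u ∈ᴸ L → v ∈ᴸ L → u ≢ v → R u v ⊎ R v u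
AllPairs-lookup (_  ∷ _)    (here refl) (here refl) u≢v = contradiction refl u≢v
AllPairs-lookup (Ru ∷ _)    (here refl) (there v∈) _    = inj₁ (All.lookup Ru v∈)
AllPairs-lookup (Rv ∷ _)    (there u∈)  (here refl) _   = inj₂ (All.lookup Rv u∈)
AllPairs-lookup (_  ∷ rest) (there u∈)  (there v∈) u≢v  = AllPairs-lookup rest u∈ v∈ u≢v

1≤∣p∣⇒nonempty : ∀ (p : Subset n) → 1 ≤ ∣ p ∣ → Nonempty p
1≤∣p∣⇒nonempty (inside  ∷ p) _ = Fin.zero , here
1≤∣p∣⇒nonempty (outside ∷ p) 1≤∣p∣ with 1≤∣p∣⇒nonempty p 1≤∣p∣
... | u , u∈p = Fin.suc u , there u∈p

2≤∣p∣⇒two-distinct : ∀ (p : Subset n) → 2 ≤ ∣ p ∣ → ∃₂ λ u v → u ≢ v × u ∈ p × v ∈ p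
2≤∣p∣⇒two-distinct (inside ∷ p) (s≤s 1≤∣p∣) with 1≤∣p∣⇒nonempty p 1≤∣p∣
... | v , v∈p = Fin.zero , Fin.suc v , (λ ()) , here , there v∈p
2≤∣p∣⇒two-distinct (outside ∷ p) 2≤∣p∣ with 2≤∣p∣⇒two-distinct p 2≤∣p∣
... | u , v , u≢v , u∈p , v∈p =
  Fin.suc u , Fin.suc v , u≢v ∘ Fin.suc-injective , there u∈p , there v∈p

x∉p⇒∣⁅x⁆∪p∣≡1+∣p∣ : ∀ (x : Fin n) (p : Subset n) → x ∉ p → ∣ ⁅ x ⁆ ∪ p ∣ ≡ suc ∣ p ∣
x∉p⇒∣⁅x⁆∪p∣≡1+∣p∣ Fin.zero    (inside  ∷ p) x∉p = contradiction here x∉p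
x∉p⇒∣⁅x⁆∪p∣≡1+∣p∣ Fin.zero    (outside ∷ p) _   = cong (suc ∘ ∣_∣) (∪-identityˡ p)
x∉p⇒∣⁅x⁆∪p∣≡1+∣p∣ (Fin.suc x) (inside  ∷ p) x∉p = cong suc (x∉p⇒∣⁅x⁆∪p∣≡1+∣p∣ x p (x∉p ∘ there))
x∉p⇒∣⁅x⁆∪p∣≡1+∣p∣ (Fin.suc x) (outside ∷ p) x∉p = x∉p⇒∣⁅x⁆∪p∣≡1+∣p∣ x p (x∉p ∘ there)

x∈⋃⁅L⁆⇒x∈L : ∀ (L : List (Fin n)) {x} → x ∈ ⋃ (map ⁅_⁆ L) → x ∈ᴸ L
x∈⋃⁅L⁆⇒x∈L []      x∈ = contradiction x∈ ∉⊥
x∈⋃⁅L⁆⇒x∈L (u ∷ L) x∈ with x∈p∪q⁻ ⁅ u ⁆ (⋃ (map ⁅_⁆ L)) x∈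
... | inj₁ x∈⁅u⁆ = here (x∈⁅y⁆⇒x≡y u x∈⁅u⁆)
... | inj₂ x∈⋃   = there (x∈⋃⁅L⁆⇒x∈L L x∈⋃)

∣⋃⁅L⁆∣≡length : ∀ {L : List (Fin n)} → AllPairs _≢_ L → ∣ ⋃ (map ⁅_⁆ L) ∣ ≡ length L
∣⋃⁅L⁆∣≡length {n} {[]} [] = ∣⊥∣≡0 n
∣⋃⁅L⁆∣≡length {L = u ∷ L} (u≢ ∷ distinct) = trans
  (x∉p⇒∣⁅x⁆∪p∣≡1+∣p∣ u (⋃ (map ⁅_⁆ L)) (λ u∈ → All.lookup u≢ (x∈⋃⁅L⁆⇒x∈L L u∈) refl))
  (cong suc (∣⋃⁅L⁆∣≡length distinct))

∈-allSubsets : ∀ (s : Subset n) → s ∈ᴸ allSubsets n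
∈-allSubsets []            = here refl
∈-allSubsets (outside ∷ s) = ∈-++⁺ˡ (∈-map⁺ (outside ∷_) (∈-allSubsets s))
∈-allSubsets {suc n} (inside ∷ s) =
  ∈-++⁺ʳ (map (outside ∷_) (allSubsets n)) (∈-map⁺ (inside ∷_) (∈-allSubsets s))

SubsetOfSize : ℕ → Subset n → Subset n → Set
SubsetOfSize k e e′ = e′ ⊆ e × ∣ e′ ∣ ≡ k

subsetOfSize? : ∀ k (e : Subset n) → Decidable (SubsetOfSize k e)
subsetOfSize? k e e′ = (e′ ⊆? e) ×-dec (∣ e′ ∣ ≟ k)

containing₀ : ℕ → Side → Subset n → ℕ
containing₀ {n} k b e = length (filter (subsetOfSize? k (b ∷ e) ∘ (inside ∷_)) (allSubsets n))

length-subsetsOfSize-∷ : ∀ k b (e : Subset n) →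
  length (subsetsOfSize k (b ∷ e)) ≡ length (subsetsOfSize k e) + containing₀ k b e
length-subsetsOfSize-∷ {n} k b e = begin
  length (filter D (map (outside ∷_) subsets ++ map (inside ∷_) subsets))
    ≡⟨ cong length (filter-++ D (map (outside ∷_) subsets) (map (inside ∷_) subsets)) ⟩
  length (filter D (map (outside ∷_) subsets) ++ filter D (map (inside ∷_) subsets))
    ≡⟨ length-++ (filter D (map (outside ∷_) subsets)) ⟩
  length (filter D (map (outside ∷_) subsets)) + length (filter D (map (inside ∷_) subsets))
    ≡⟨ cong₂ _+_ (length-filter-map D (outside ∷_) subsets)
                 (length-filter-map D (inside ∷_) subsets) ⟩
  length (filter (D ∘ (outside ∷_)) subsets) + containing₀ k b e
    ≡⟨ cong (λ l → length l + containing₀ k b e)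
            (filter-≐ (D ∘ (outside ∷_)) (subsetOfSize? k e) outside≐ subsets) ⟩
  length (subsetsOfSize k e) + containing₀ k b e ∎
  where
  subsets : List (Subset n)
  subsets = allSubsets n
  D : Decidable (SubsetOfSize k (b ∷ e))
  D = subsetOfSize? k (b ∷ e)
  outside≐ : SubsetOfSize k (b ∷ e) ∘ (outside ∷_) ≐ SubsetOfSize k e
  outside≐ = (λ (⊆e , size) → drop-∷-⊆ ⊆e , size) , (λ (⊆e , size) → out⊆ ⊆e , size)

containing₀-outside : ∀ k (e : Subset n) → containing₀ k outside e ≡ 0
containing₀-outside {n} k e = cong length (filter-none _ (All.universal none (allSubsets n)))
  where
  none : ∀ x → ¬ SubsetOfSize k (outside ∷ e) (inside ∷ x)
  none x (⊆e , _) with ⊆e here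
  ... | ()

containing₀-zero : ∀ (e : Subset n) → containing₀ 0 inside e ≡ 0
containing₀-zero {n} e = cong length (filter-none _ (All.universal none (allSubsets n)))
  where
  none : ∀ x → ¬ SubsetOfSize 0 (inside ∷ e) (inside ∷ x)
  none x (_ , ())

containing₀-suc : ∀ k (e : Subset n) → containing₀ (suc k) inside e ≡ length (subsetsOfSize k e)
containing₀-suc {n} k e = cong length (filter-≐ _ (subsetOfSize? k e) inside≐ (allSubsets n))
  where
  inside≐ : SubsetOfSize (suc k) (inside ∷ e) ∘ (inside ∷_) ≐ SubsetOfSize k e
  inside≐ = (λ (⊆e , size) → drop-∷-⊆ ⊆e , suc-injective size)
          , (λ (⊆e , size) → in⊆in ⊆e , cong suc size)

length-subsetsOfSize : ∀ k (e : Subset n) → length (subsetsOfSize k e) ≡ ∣ e ∣ C k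
length-subsetsOfSize zero    [] = refl
length-subsetsOfSize (suc k) [] = refl
length-subsetsOfSize k (b ∷ e) = begin
  length (subsetsOfSize k (b ∷ e))
    ≡⟨ length-subsetsOfSize-∷ k b e ⟩
  length (subsetsOfSize k e) + containing₀ k b e
    ≡⟨ cong (_+ containing₀ k b e) (length-subsetsOfSize k e) ⟩
  ∣ e ∣ C k + containing₀ k b e
    ≡⟨ pascal k b ⟩
  ∣ b ∷ e ∣ C k ∎
  where
  pascal : ∀ k b → ∣ e ∣ C k + containing₀ k b e ≡ ∣ b ∷ e ∣ C k
  pascal k outside = trans (cong (∣ e ∣ C k +_) (containing₀-outside k e)) (+-identityʳ _)
  pascal zero inside = cong (∣ e ∣ C 0 +_) (containing₀-zero e)
  pascal (suc k) inside = begin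
    ∣ e ∣ C suc k + containing₀ (suc k) inside e
      ≡⟨ cong (∣ e ∣ C suc k +_) (containing₀-suc k e) ⟩
    ∣ e ∣ C suc k + length (subsetsOfSize k e)
      ≡⟨ cong (∣ e ∣ C suc k +_) (length-subsetsOfSize k e) ⟩
    ∣ e ∣ C suc k + ∣ e ∣ C k
      ≡⟨ +-comm (∣ e ∣ C suc k) (∣ e ∣ C k) ⟩
    ∣ e ∣ C k + ∣ e ∣ C suc k
      ≡⟨ nCk+nC[k+1]≡[n+1]C[k+1] ∣ e ∣ k ⟩
    suc ∣ e ∣ C suc k ∎

Independent : Rel (Fin n) ℓ → Subset n → Set ℓ
Independent R e = ∀ {u v} → u ∈ e → v ∈ e → u ≢ v → ¬ R u v

large-independent-subset : ∀ {R : Rel (Fin n) ℓ} {X : Subset n} {L : List (Fin n)} m → Symmetric R →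
  All (_∈ X) L → AllPairs (λ u v → u ≢ v × ¬ R u v) L → m ≤ length L →
  ∃ λ e → e ⊆ X × ∣ e ∣ ≡ m × Independent R e
large-independent-subset {n = n} {R = R} {X} {L} m R-sym L⊆X independentL m≤∣L∣ =
  e , e⊆X , ∣e∣≡m , e-independent
  where
  L′ : List (Fin n)
  L′ = take m L
  independentL′ : AllPairs (λ u v → u ≢ v × ¬ R u v) L′
  independentL′ = AllPairs.take⁺ m independentL
  e : Subset n
  e = ⋃ (map ⁅_⁆ L′)
  e⊆X : e ⊆ X
  e⊆X x∈e = All.lookup (All.take⁺ m L⊆X) (x∈⋃⁅L⁆⇒x∈L L′ x∈e)
  ∣e∣≡m : ∣ e ∣ ≡ m
  ∣e∣≡m = begin
    ∣ e ∣              ≡⟨ ∣⋃⁅L⁆∣≡length (AllPairs.map (λ (u≢v , _) → u≢v) independentL′) ⟩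
    length L′          ≡⟨ length-take m L ⟩
    m ⊓ length L       ≡⟨ m≤n⇒m⊓n≡m m≤∣L∣ ⟩
    m                  ∎
  e-independent : Independent R e
  e-independent u∈e v∈e u≢v uRv
    with AllPairs-lookup independentL′ (x∈⋃⁅L⁆⇒x∈L L′ u∈e) (x∈⋃⁅L⁆⇒x∈L L′ v∈e) u≢v
  ... | inj₁ (_ , ¬uRv) = ¬uRv uRv
  ... | inj₂ (_ , ¬vRu) = ¬vRu (R-sym uRv)

module Hypergraph (k : ℕ) (f : Colouring n) (X : Subset n) (c : F₂) where

  Adjacent-sym : Symmetric (Adjacent k f X c)
  Adjacent-sym (h , edge , u∈h , v∈h) = h , edge , v∈h , u∈h

  adjacent? : ∀ u → Decidable (Adjacent k f X c u)
  adjacent? u v = map′ satisfied (λ (h , h-joins) → lose (∈-allSubsets h) h-joins)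
    (Any.any? (λ h → ((h ⊆? X) ×-dec (∣ h ∣ ≟ k) ×-dec (f h ≟ᴮ c)) ×-dec (u ∈? h) ×-dec (v ∈? h))
              (allSubsets n))

  colour-≢ : ∀ {e e′} → 2 ≤ k → e ⊆ X → Independent (Adjacent k f X c) e →
             e′ ⊆ e → ∣ e′ ∣ ≡ k → f e′ ≢ c
  colour-≢ {e′ = e′} 2≤k e⊆X independent e′⊆e ∣e′∣≡k fe′≡c
    with 2≤∣p∣⇒two-distinct e′ (subst (2 ≤_) (sym ∣e′∣≡k) 2≤k)
  ... | u , v , u≢v , u∈e′ , v∈e′ =
    independent (e′⊆e u∈e′) (e′⊆e v∈e′) u≢v (e′ , (e⊆X ∘ e′⊆e , ∣e′∣≡k , fe′≡c) , u∈e′ , v∈e′)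

  Ψ-independent : ∀ {e} → 2 ≤ k → suc k % 2 ≡ 1 → e ⊆ X → ∣ e ∣ ≡ suc k →
                  Independent (Adjacent k f X c) e → Ψ k f e ≡ not c
  Ψ-independent {e} 2≤k odd e⊆X ∣e∣≡1+k independent =
    sumF₂-constant (All.map⁺ (All.tabulate colour)) (subst (λ m → m % 2 ≡ 1) (sym count) odd)
    where
    colour : ∀ {e′} → e′ ∈ᴸ subsetsOfSize k e → f e′ ≡ not c
    colour e′∈ with ∈-filter⁻ (subsetOfSize? k e) {xs = allSubsets n} e′∈
    ... | _ , e′⊆e , ∣e′∣≡k = ¬-not (colour-≢ 2≤k e⊆X independent e′⊆e ∣e′∣≡k)
    count : length (map f (subsetsOfSize k e)) ≡ suc k
    count = begin
      length (map f (subsetsOfSize k e)) ≡⟨ length-map f (subsetsOfSize k e) ⟩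
      length (subsetsOfSize k e)         ≡⟨ length-subsetsOfSize k e ⟩
      ∣ e ∣ C k                          ≡⟨ cong (_C k) ∣e∣≡1+k ⟩
      suc k C k                          ≡⟨ [1+k]Ck≡1+k k ⟩
      suc k                              ∎

  independent-bound : ∀ {L} → 2 ≤ k → suc k % 2 ≡ 1 →
    (∀ e → e ⊆ X → ∣ e ∣ ≡ suc k → Ψ k f e ≡ c) →
    All (_∈ X) L → AllPairs (λ u v → u ≢ v × ¬ Adjacent k f X c u v) L → length L ≤ k
  independent-bound {L} 2≤k odd Ψ≡c L⊆X independentL with length L ≤? k
  ... | yes ∣L∣≤k = ∣L∣≤k
  ... | no ∣L∣≰k with large-independent-subset (suc k) Adjacent-sym L⊆X independentL (≰⇒> ∣L∣≰k)
  ...   | e , e⊆X , ∣e∣≡1+k , independent =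
    contradiction (Ψ-independent 2≤k odd e⊆X ∣e∣≡1+k independent) (not-¬ (Ψ≡c e e⊆X ∣e∣≡1+k))

  dominated⇒connected : ∀ {v u} → u ∈ X × (v ≡ u ⊎ Adjacent k f X c v u) →
                        u ∈ X × Connected k f X c v u
  dominated⇒connected (u∈X , inj₁ refl) = u∈X , ε
  dominated⇒connected (u∈X , inj₂ adj)  = u∈X , adj ◅ ε

theorem6 : (r n : ℕ) → 3 ≤ r → r % 2 ≡ 1 → r ≤ n →
           (f : Colouring n) (X : Subset n) (c : F₂) →
           (∀ (e : Subset n) → e ⊆ X → ∣ e ∣ ≡ r → Ψ (r ∸ 1) f e ≡ c) →
           AtMostComponents (r ∸ 1) (r ∸ 1) f X c
theorem6 (suc k) n (s≤s 2≤k) odd _ f X c Ψ≡c =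
  let L , L⊆X , independentL , dominated = maximalIndependent (allFin n)
  in  L , independent-bound 2≤k odd Ψ≡c L⊆X independentL ,
      λ v v∈X → Any.map dominated⇒connected (dominated (∈-allFin v) v∈X)
  where
  open Hypergraph k f X c
  open Greedy Fin._≟_ (_∈? X) adjacent?
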